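{- For every integer $k\ge2$, the minimum dimension of a generalized Cartan matrix of type $N_k$ is $k$.
   Context: A generalized Cartan matrix (GCM) is an $\ell\times\ell$ integer matrix $A=(a_{ij})$ with $a_{ii}=2$, $a_{ij}\le 0$ for $i\neq j$, and $a_{ij}=0$ if and only if $a_{ji}=0$; its dimension is $\ell$. A principal submatrix is obtained by deleting some rows and the columns with the same indices. GCMs are assumed symmetrizable (some invertible diagonal $D$ makes $DA$ symmetric) and indecomposable (not block diagonal after a simultaneous permutation of rows and columns). Vector inequalities are entrywise. An indecomposable GCM is of finite type if $\det A\neq0$, there is $u>0$ with $Au>0$, and $Au\ge0$ implies $u>0$ or $u=0$; of affine type if $\operatorname{corank}A=1$, there is $u>0$ with $Au=0$, and $Au\ge0$ implies $Au=0$. It is hyperbolic if it is neither finite nor affine but every proper indecomposable principal submatrix is finite or affine. Type $N_0$ = finite, $N_1$ = affine, $N_2$ = hyperbolic; for $k\ge3$, a GCM is of type $N_k$ if it contains at least one principal submatrix of type $N_{k-1}$ and every other (indecomposable) principal submatrix is of type $N_m$ for some $m<k$.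
   Formalization: The vectors u in the definitions of finite and affine type, the kernel vectors giving the corank, and the symmetrizing diagonal matrix D have rational entries. -}

module Defs where

open import Data.Nat as ℕ using (ℕ; zero; suc)
open import Data.Fin using (Fin; zero; suc; punchIn; toℕ)
open import Data.Integer as ℤ using (ℤ; +_)
open import Data.Rational as ℚ using (ℚ; 0ℚ)
open import Data.Product using (Σ; ∃; _×_; _,_)
open import Data.Sum using (_⊎_)
open import Data.Bool using (Bool; true; false)
open import Data.Empty using (⊥)
open import Relation.Binary.PropositionalEquality using (_≡_; _≢_)
open import Relation.Nullary using (¬_)

Mat : ℕ → Set
Mat n = Fin n → Fin n → ℤ

Vecℚ : ℕ → Set
Vecℚ n = Fin n → ℚ

sumℤ : ∀ {n} → (Fin n → ℤ) → ℤ
sumℤ {zero}  f = + 0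
sumℤ {suc n} f = f zero ℤ.+ sumℤ (λ i → f (suc i))

sumℚ : ∀ {n} → (Fin n → ℚ) → ℚ
sumℚ {zero}  f = 0ℚ
sumℚ {suc n} f = f zero ℚ.+ sumℚ (λ i → f (suc i))

toℚ : ℤ → ℚ
toℚ z = z ℚ./ 1

det : ∀ {n} → Mat n → ℤ
det {zero}  A = + 1
det {suc n} A =
  sumℤ (λ j → (sign j ℤ.* A zero j) ℤ.* det (λ r c → A (suc r) (punchIn j c)))
  where
  sign : Fin (suc n) → ℤ
  sign j with toℕ j ℕ.% 2
  ... | zero = + 1
  ... | suc _ = ℤ.- (+ 1)

_·_ : ∀ {n} → Mat n → Vecℚ n → Vecℚ n
(A · u) i = sumℚ (λ j → toℚ (A i j) ℚ.* u j)

Pos : ∀ {n} → Vecℚ n → Set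
Pos u = ∀ i → 0ℚ ℚ.< u i

NonNeg : ∀ {n} → Vecℚ n → Set
NonNeg u = ∀ i → 0ℚ ℚ.≤ u i

Zero : ∀ {n} → Vecℚ n → Set
Zero u = ∀ i → u i ≡ 0ℚ

IsGCM : ∀ {n} → Mat n → Set
IsGCM {n} A =
  (∀ i → A i i ≡ + 2) ×
  (∀ i j → i ≢ j → A i j ℤ.≤ + 0) ×
  (∀ i j → A i j ≡ + 0 → A j i ≡ + 0)

IsSymmetrizable : ∀ {n} → Mat n → Set
IsSymmetrizable {n} A =
  Σ (Fin n → ℚ) λ d → (∀ i → d i ≢ 0ℚ) ×
    (∀ i j → d i ℚ.* toℚ (A i j) ≡ d j ℚ.* toℚ (A j i))

-- Decomposable: the index set splits into two nonempty parts S, Sᶜ with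
-- a_ij = 0 for i ∈ S, j ∉ S (equivalently, block diagonal after a
-- simultaneous permutation of rows and columns).
IsIndecomposable : ∀ {n} → Mat n → Set
IsIndecomposable {n} A =
  ¬ (Σ (Fin n → Bool) λ S →
       (∃ λ i → S i ≡ true) × (∃ λ j → S j ≡ false) ×
       (∀ i j → S i ≡ true → S j ≡ false → A i j ≡ + 0))

IsStdGCM : ∀ {n} → Mat n → Set
IsStdGCM A = IsGCM A × IsSymmetrizable A × IsIndecomposable A

-- Principal submatrices of dimension m: choose m indices
-- f 0 < f 1 < ... < f (m-1) and keep those rows and columns.
StrictIncr : ∀ {m n} → (Fin m → Fin n) → Set
StrictIncr {m} f = ∀ (i j : Fin m) → toℕ i ℕ.< toℕ j → toℕ (f i) ℕ.< toℕ (f j)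

sub : ∀ {m n} → Mat n → (Fin m → Fin n) → Mat m
sub A f i j = A (f i) (f j)

IsFinite : ∀ {n} → Mat n → Set
IsFinite {n} A =
  det A ≢ + 0 ×
  (Σ (Vecℚ n) λ u → Pos u × Pos (A · u)) ×
  (∀ u → NonNeg (A · u) → Pos u ⊎ Zero u)

Corank1 : ∀ {n} → Mat n → Set
Corank1 {n} A =
  Σ (Vecℚ n) λ v → ¬ Zero v × Zero (A · v) ×
    (∀ w → Zero (A · w) → Σ ℚ λ c → ∀ i → w i ≡ c ℚ.* v i)

IsAffine : ∀ {n} → Mat n → Set
IsAffine {n} A =
  Corank1 A ×
  (Σ (Vecℚ n) λ u → Pos u × Zero (A · u)) ×
  (∀ u → NonNeg (A · u) → Zero (A · u))

IsHyperbolic : ∀ {n} → Mat n → Set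
IsHyperbolic {n} A =
  ¬ IsFinite A × ¬ IsAffine A ×
  (∀ m (f : Fin (suc m) → Fin n) → StrictIncr f → suc m ℕ.< n →
     IsIndecomposable (sub A f) → IsFinite (sub A f) ⊎ IsAffine (sub A f))

-- TypeN k A : A is (indecomposable and) of type N_k.
-- TypeLt k A : A is of type N_m for some m < k.
mutual
  TypeN : ℕ → ∀ {n} → Mat n → Set
  TypeN zero A = IsIndecomposable A × IsFinite A
  TypeN (suc zero) A = IsIndecomposable A × IsAffine A
  TypeN (suc (suc zero)) A = IsIndecomposable A × IsHyperbolic A
  TypeN (suc (suc (suc k))) {n} A =
    IsIndecomposable A ×
    (Σ ℕ λ m → Σ (Fin (suc m) → Fin n) λ f →
       StrictIncr f × suc m ℕ.< n × TypeN (suc (suc k)) (sub A f)) ×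
    (∀ m (f : Fin (suc m) → Fin n) → StrictIncr f → suc m ℕ.< n →
       IsIndecomposable (sub A f) → TypeLt (suc (suc (suc k))) (sub A f))

  TypeLt : ℕ → ∀ {n} → Mat n → Set
  TypeLt zero A = ⊥
  TypeLt (suc k) A = TypeLt k A ⊎ TypeN k A

-- The k × k matrix with 2 on the diagonal and -3 elsewhere is of type N_k.
-- Its principal submatrices have the same shape, so by induction it suffices
-- that the 2 × 2 one is hyperbolic: u = (-1, -1) gives Au = (1, 1) ≥ 0 although
-- u is neither positive nor zero and Au ≠ 0, and its 1 × 1 submatrices (2) are
-- finite. Conversely, a matrix of type N_k contains a principal submatrix of
-- type N_(k-1) of strictly smaller dimension, and a hyperbolic matrix has
-- dimension at least 2 because those of dimension 0 and 1 are finite.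
module Submission where

open import Defs
open import Data.Nat using (ℕ; _≤_)
open import Data.Product using (Σ; _×_)

open import Data.Nat as ℕ using (zero; suc; _+_; z≤n; s≤s)
import Data.Nat.Properties as ℕP
open import Data.Nat.Induction using (<-rec)
open import Data.Fin as Fin using (Fin; zero; suc; toℕ)
import Data.Fin.Properties as FinP
open import Data.Integer as ℤ using (ℤ; +_)
import Data.Integer.Properties as ℤP
open import Data.Rational as ℚ using (0ℚ; 1ℚ)
import Data.Rational.Properties as ℚP
open import Data.Product using (_,_; proj₁; proj₂)
open import Data.Sum using (_⊎_; inj₁; inj₂)
open import Data.Bool using (true; false)
open import Data.Empty using (⊥-elim)
open import Function using (_∘_)
open import Relation.Nullary using (¬_; yes; no)
open import Relation.Binary using (tri<; tri≈; tri>)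
open import Relation.Binary.PropositionalEquality

StrictIncr⇒injective : ∀ {m n} (f : Fin m → Fin n) → StrictIncr f →
                       ∀ i j → i ≢ j → f i ≢ f j
StrictIncr⇒injective f incr i j i≢j fi≡fj with ℕP.<-cmp (toℕ i) (toℕ j)
... | tri< i<j _ _ = ℕP.<-irrefl (cong toℕ fi≡fj) (incr i j i<j)
... | tri≈ _ i≡j _ = i≢j (FinP.toℕ-injective i≡j)
... | tri> _ _ j<i = ℕP.<-irrefl (cong toℕ (sym fi≡fj)) (incr j i j<i)

isFinite-dim0 : (A : Mat 0) → IsFinite A
isFinite-dim0 A = (λ ()) , ((λ ()) , (λ ()) , (λ ())) , (λ u _ → inj₂ (λ ()))

isFinite-dim1 : (A : Mat 1) → A zero zero ≡ + 2 → IsFinite A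
isFinite-dim1 A a≡2 = det≢0 , (one , (λ _ → ℚP.positive⁻¹ 1ℚ) , A·one>0) , signs
  where
  det≡2 : det A ≡ + 2
  det≡2 rewrite a≡2 = refl

  det≢0 : det A ≢ + 0
  det≢0 eq with trans (sym det≡2) eq
  ... | ()

  one : Vecℚ 1
  one _ = 1ℚ

  A·one>0 : Pos (A · one)
  A·one>0 zero rewrite a≡2 = ℚP.positive⁻¹ _

  A·u≡2u : ∀ u → (A · u) zero ≡ toℚ (+ 2) ℚ.* u zero
  A·u≡2u u rewrite a≡2 = ℚP.+-identityʳ _

  signs : ∀ u → NonNeg (A · u) → Pos u ⊎ Zero u
  signs u A·u≥0 with ℚP.<-cmp (u zero) 0ℚ
  ... | tri< u<0 _ _ = ⊥-elim (ℚP.<-irrefl refl (ℚP.≤-<-trans 0≤2u 2u<0))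
    where
    0≤2u : 0ℚ ℚ.≤ toℚ (+ 2) ℚ.* u zero
    0≤2u = subst (0ℚ ℚ.≤_) (A·u≡2u u) (A·u≥0 zero)
    2u<0 : toℚ (+ 2) ℚ.* u zero ℚ.< 0ℚ
    2u<0 = subst (toℚ (+ 2) ℚ.* u zero ℚ.<_) (ℚP.*-zeroʳ (toℚ (+ 2)))
                 (ℚP.*-monoʳ-<-pos (toℚ (+ 2)) u<0)
  ... | tri≈ _ u≡0 _ = inj₂ (λ { zero → u≡0 })
  ... | tri> _ _ u>0 = inj₁ (λ { zero → u>0 })

TypeN⇒TypeLt : ∀ {n} (A : Mat n) j k → j ℕ.< k → TypeN j A → TypeLt k A
TypeN⇒TypeLt A j (suc k) (s≤s j≤k) t with ℕP.m≤n⇒m<n∨m≡n j≤k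
... | inj₁ j<k  = inj₁ (TypeN⇒TypeLt A j k j<k t)
... | inj₂ refl = inj₂ t

Uniform : ℤ → ∀ {n} → Mat n → Set
Uniform a A = (∀ i → A i i ≡ + 2) × (∀ i j → i ≢ j → A i j ≡ a)

uniform : ℤ → ∀ n → Mat n
uniform a n i j with i Fin.≟ j
... | yes _ = + 2
... | no _  = a

uniform-Uniform : ∀ a n → Uniform a (uniform a n)
uniform-Uniform a n = diagonal , offDiagonal
  where
  diagonal : ∀ i → uniform a n i i ≡ + 2
  diagonal i with i Fin.≟ i
  ... | yes _ = refl
  ... | no i≢i = ⊥-elim (i≢i refl)
  offDiagonal : ∀ i j → i ≢ j → uniform a n i j ≡ a
  offDiagonal i j i≢j with i Fin.≟ j
  ... | yes i≡j = ⊥-elim (i≢j i≡j)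
  ... | no _ = refl

Uniform-sub : ∀ {a m n} {A : Mat n} (f : Fin m → Fin n) → StrictIncr f →
              Uniform a A → Uniform a (sub A f)
Uniform-sub f incr (diagonal , offDiagonal) =
  (λ i → diagonal (f i)) ,
  (λ i j i≢j → offDiagonal (f i) (f j) (StrictIncr⇒injective f incr i j i≢j))

Uniform-sym : ∀ {a n} {A : Mat n} → Uniform a A → ∀ i j → A i j ≡ A j i
Uniform-sym (_ , offDiagonal) i j with i Fin.≟ j
... | yes refl = refl
... | no i≢j = trans (offDiagonal i j i≢j) (sym (offDiagonal j i (i≢j ∘ sym)))

Uniform-indecomposable : ∀ {a n} {A : Mat n} → a ≢ + 0 → Uniform a A → IsIndecomposable A
Uniform-indecomposable a≢0 (_ , offDiagonal) (S , (i , Si) , (j , Sj) , Aij≡0) with i Fin.≟ j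
... | yes refl = true≢false (trans (sym Si) Sj)
  where
  true≢false : true ≢ false
  true≢false ()
... | no i≢j = a≢0 (trans (sym (offDiagonal i j i≢j)) (Aij≡0 i j Si Sj))

Uniform-isStdGCM : ∀ {a n} {A : Mat n} → a ℤ.< + 0 → Uniform a A → IsStdGCM A
Uniform-isStdGCM {a} {A = A} a<0 U@(diagonal , offDiagonal) =
  (diagonal , offDiagonal≤0 , zeroSym) ,
  ((λ _ → 1ℚ) , (λ _ ()) , (λ i j → cong (λ z → 1ℚ ℚ.* toℚ z) (Uniform-sym U i j))) ,
  Uniform-indecomposable (ℤP.<⇒≢ a<0) U
  where
  offDiagonal≤0 : ∀ i j → i ≢ j → A i j ℤ.≤ + 0
  offDiagonal≤0 i j i≢j rewrite offDiagonal i j i≢j = ℤP.<⇒≤ a<0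
  zeroSym : ∀ i j → A i j ≡ + 0 → A j i ≡ + 0
  zeroSym i j Aij≡0 = trans (Uniform-sym U j i) Aij≡0

-3ℤ : ℤ
-3ℤ = ℤ.- (+ 3)

-3ℤ<0 : -3ℤ ℤ.< + 0
-3ℤ<0 = ℤ.-<+

module Uniform-3-Dim2 (A : Mat 2) (U : Uniform -3ℤ A) where

  -one : Vecℚ 2
  -one _ = ℚ.- 1ℚ

  A·-one≡one : ∀ i → (A · -one) i ≡ 1ℚ
  A·-one≡one zero rewrite proj₁ U zero | proj₂ U zero (suc zero) (λ ()) = refl
  A·-one≡one (suc zero)
    rewrite proj₁ U (suc zero) | proj₂ U (suc zero) zero (λ ()) = refl

  A·-one≥0 : NonNeg (A · -one)
  A·-one≥0 i = subst (0ℚ ℚ.≤_) (sym (A·-one≡one i)) (ℚP.<⇒≤ (ℚP.positive⁻¹ 1ℚ))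

  ¬isFinite : ¬ IsFinite A
  ¬isFinite (_ , _ , signs) with signs -one A·-one≥0
  ... | inj₁ -one>0 = ℚP.<-irrefl refl (ℚP.<-trans (-one>0 zero) (ℚP.negative⁻¹ (ℚ.- 1ℚ)))
  ... | inj₂ -one≡0 with -one≡0 zero
  ... | ()

  ¬isAffine : ¬ IsAffine A
  ¬isAffine (_ , _ , A·u≥0⇒A·u≡0)
    with trans (sym (A·-one≡one zero)) (A·u≥0⇒A·u≡0 -one A·-one≥0 zero)
  ... | ()

  isHyperbolic : IsHyperbolic A
  isHyperbolic = ¬isFinite , ¬isAffine , proper
    where
    proper : ∀ m (f : Fin (suc m) → Fin 2) → StrictIncr f → suc m ℕ.< 2 →
             IsIndecomposable (sub A f) → IsFinite (sub A f) ⊎ IsAffine (sub A f)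
    proper zero f _ _ _ = inj₁ (isFinite-dim1 (sub A f) (proj₁ U (f zero)))
    proper (suc m) f _ (s≤s (s≤s ())) _

Uniform-3⇒TypeN : ∀ m (A : Mat (2 + m)) → Uniform -3ℤ A → TypeN (2 + m) A
Uniform-3⇒TypeN = <-rec (λ m → ∀ A → Uniform -3ℤ A → TypeN (2 + m) A) step
  where
  step : ∀ m → (∀ {j} → j ℕ.< m → ∀ A → Uniform -3ℤ A → TypeN (2 + j) A) →
         ∀ A → Uniform -3ℤ A → TypeN (2 + m) A
  step zero _ A U =
    Uniform-indecomposable (ℤP.<⇒≢ -3ℤ<0) U , Uniform-3-Dim2.isHyperbolic A U
  step (suc m) rec A U =
    Uniform-indecomposable (ℤP.<⇒≢ -3ℤ<0) U ,
    (suc m , suc , (λ _ _ → s≤s) , ℕP.≤-refl ,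
      rec ℕP.≤-refl (sub A suc) (Uniform-sub suc (λ _ _ → s≤s) U)) ,
    proper
    where
    proper : ∀ j (f : Fin (suc j) → Fin (3 + m)) → StrictIncr f → suc j ℕ.< 3 + m →
             IsIndecomposable (sub A f) → TypeLt (3 + m) (sub A f)
    proper zero f _ _ indec =
      TypeN⇒TypeLt (sub A f) 0 _ (s≤s z≤n)
        (indec , isFinite-dim1 (sub A f) (proj₁ U (f zero)))
    proper (suc j) f incr (s≤s (s≤s j<1+m)) _ =
      TypeN⇒TypeLt (sub A f) (2 + j) _ (s≤s (s≤s j<1+m))
        (rec j<1+m (sub A f) (Uniform-sub f incr U))

TypeN⇒≤dim : ∀ k {n} (A : Mat n) → (∀ i → A i i ≡ + 2) → TypeN (2 + k) A → 2 + k ≤ n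
TypeN⇒≤dim zero {zero} A _ (_ , ¬finite , _) = ⊥-elim (¬finite (isFinite-dim0 A))
TypeN⇒≤dim zero {suc zero} A diagonal (_ , ¬finite , _) =
  ⊥-elim (¬finite (isFinite-dim1 A (diagonal zero)))
TypeN⇒≤dim zero {suc (suc n)} _ _ _ = s≤s (s≤s z≤n)
TypeN⇒≤dim (suc k) A diagonal (_ , (m , f , _ , 1+m<n , typeN) , _) =
  ℕP.≤-trans (s≤s (TypeN⇒≤dim k (sub A f) (λ i → diagonal (f i)) typeN)) 1+m<n

proposition4p2 : ∀ (k : ℕ) → 2 ≤ k →
    (Σ (Mat k) λ A → IsStdGCM A × TypeN k A) ×
    (∀ (n : ℕ) (A : Mat n) → IsStdGCM A → TypeN k A → k ≤ n)
proposition4p2 (suc zero) (s≤s ())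
proposition4p2 (suc (suc k)) _ =
  (uniform -3ℤ (2 + k) , Uniform-isStdGCM -3ℤ<0 U , Uniform-3⇒TypeN k _ U) ,
  (λ n A ((diagonal , _) , _) → TypeN⇒≤dim k A diagonal)
  where
  U : Uniform -3ℤ (uniform -3ℤ (2 + k))
  U = uniform-Uniform -3ℤ (2 + k)
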